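{- Let $n\ge1$. Then the free algebra $\mathbf F_{\mathcal V_n}(1)$ on one generator in $\mathcal V_n$ satisfies \[|F_{\mathcal V_n}(1)|=\tfrac12\big(n^6+10n^5+42n^4+102n^3+157n^2+148n+72\big).\]
   Context: The algebra $\mathbf J_n$ has universe $\{\top,\boldsymbol f_0,\dots,\boldsymbol f_n,\boldsymbol t_0,\dots,\boldsymbol t_n,\bot\}$ and operations $\otimes,\oplus,\wedge,\vee,\neg$ together with every element as a nullary operation. The knowledge order $\le_k$ consists of the two chains $\bot<\boldsymbol f_n<\dots<\boldsymbol f_1<\boldsymbol f_0<\top$ and $\bot<\boldsymbol t_n<\dots<\boldsymbol t_1<\boldsymbol t_0<\top$ (elements from different chains other than $\bot,\top$ incomparable); the truth order $\le_t$ is $\boldsymbol f_0<\boldsymbol f_1<\dots<\boldsymbol f_n<\top,\bot<\boldsymbol t_n<\dots<\boldsymbol t_1<\boldsymbol t_0$ with $\top$ and $\bot$ incomparable. $\otimes,\oplus$ are meet and join for $\le_k$; $\wedge,\vee$ are meet and join for $\le_t$; $\neg\boldsymbol f_m=\boldsymbol t_m$, $\neg\boldsymbol t_m=\boldsymbol f_m$, $\neg\top=\top$, $\neg\bot=\bot$. $\mathcal V_n$ is the variety generated by $\mathbf J_n$. -}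

module Defs where

open import Data.Nat using (ℕ; suc; _≤ᵇ_)
open import Data.Fin using (Fin; toℕ)
import Data.Fin
open import Data.Bool using (if_then_else_)
open import Data.List using (List)
open import Data.List.Relation.Unary.Any using (Any)
open import Data.List.Relation.Unary.AllPairs using (AllPairs)
open import Relation.Binary.PropositionalEquality using (_≡_)
open import Relation.Nullary using (¬_)

data J (n : ℕ) : Set where
  top bot : J n
  f t : Fin (suc n) → J n

minF maxF : ∀ {m} → Fin m → Fin m → Fin m
minF i j = if toℕ i ≤ᵇ toℕ j then i else j
maxF i j = if toℕ i ≤ᵇ toℕ j then j else i

-- ⊗ : meet in the knowledge order (f_i ≤k f_j iff j ≤ i, same for t)
_⊗_ : ∀ {n} → J n → J n → J n
top ⊗ y = y
bot ⊗ y = bot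
x ⊗ top = x
x ⊗ bot = bot
f i ⊗ f j = f (maxF i j)
t i ⊗ t j = t (maxF i j)
f i ⊗ t j = bot
t i ⊗ f j = bot

_⊕_ : ∀ {n} → J n → J n → J n
bot ⊕ y = y
top ⊕ y = top
x ⊕ bot = x
x ⊕ top = top
f i ⊕ f j = f (minF i j)
t i ⊕ t j = t (minF i j)
f i ⊕ t j = top
t i ⊕ f j = top

-- ∧ : meet in the truth order
-- f_0 < ... < f_n < ⊤,⊥ < t_n < ... < t_0
_∧_ : ∀ {n} → J n → J n → J n
f i ∧ f j = f (minF i j)
f i ∧ y = f i
x ∧ f j = f j
t i ∧ t j = t (maxF i j)
t i ∧ y = y
x ∧ t j = x
top ∧ top = top
bot ∧ bot = bot
top ∧ bot = f (Data.Fin.fromℕ _)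
bot ∧ top = f (Data.Fin.fromℕ _)

_∨_ : ∀ {n} → J n → J n → J n
t i ∨ t j = t (minF i j)
t i ∨ y = t i
x ∨ t j = t j
f i ∨ f j = f (maxF i j)
f i ∨ y = y
x ∨ f j = x
top ∨ top = top
bot ∨ bot = bot
top ∨ bot = t (Data.Fin.fromℕ _)
bot ∨ top = t (Data.Fin.fromℕ _)

neg : ∀ {n} → J n → J n
neg top = top
neg bot = bot
neg (f i) = t i
neg (t i) = f i

data Term (n : ℕ) : Set where
  var : Term n
  con : J n → Term n
  _⊗ₜ_ _⊕ₜ_ _∧ₜ_ _∨ₜ_ : Term n → Term n → Term n
  negₜ : Term n → Term n

⟦_⟧ : ∀ {n} → Term n → J n → J n
⟦ var ⟧ a = a
⟦ con c ⟧ a = c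
⟦ s ⊗ₜ u ⟧ a = ⟦ s ⟧ a ⊗ ⟦ u ⟧ a
⟦ s ⊕ₜ u ⟧ a = ⟦ s ⟧ a ⊕ ⟦ u ⟧ a
⟦ s ∧ₜ u ⟧ a = ⟦ s ⟧ a ∧ ⟦ u ⟧ a
⟦ s ∨ₜ u ⟧ a = ⟦ s ⟧ a ∨ ⟦ u ⟧ a
⟦ negₜ s ⟧ a = neg (⟦ s ⟧ a)

-- s ≈ u in F_{V_n}(1): the identity s(x) ≈ u(x) holds in V_n,
-- equivalently (V_n = V(J_n)) holds in J_n.
_≈ₜ_ : ∀ {n} → Term n → Term n → Set
s ≈ₜ u = ∀ a → ⟦ s ⟧ a ≡ ⟦ u ⟧ a

-- F_{V_n}(1) has exactly the (distinct) elements represented by ts: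
-- the terms in ts are pairwise non-equivalent, and every term is
-- equivalent to one of them.
IsTransversal : ∀ {n} → List (Term n) → Set
IsTransversal ts = AllPairs (λ s u → ¬ (s ≈ₜ u)) ts × (∀ u → Any (λ s → s ≈ₜ u) ts)
  where open import Data.Product using (_×_)

{-# OPTIONS --safe #-}
-- A unary term operation g of J n is determined by six values: g ⊤, g ⊥ and the images of the
-- endpoints of the chains f₀ < … < fₙ and t₀ < … < tₙ. Indeed, on each chain g is constantly ⊥,
-- constantly ⊤, or a clamp i ↦ max a (min i b) with a ≤ b into one of the two chains, and this
-- shape is preserved by all operations. Collapsing each chain to a point is a homomorphism onto
-- J 0 = FOUR, whose operations are monotone for the knowledge order; so the kind of g ⊥ lies below,
-- and the kind of g ⊤ above, the kinds of g f₀ and g t₀. Conversely every six-tuple of this shape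
-- is the code of a term, a ⊕-join of four simple terms. Hence |F(1)| is the number of such
-- six-tuples; grouped by the kinds of the two chain images it is a sum of 16 products, in which
-- each chain has (n + 1)(n + 2)/2 possible clamp images.
module Submission where

open import Defs
open import Data.Bool using (Bool; true; false; T)
open import Data.Fin using (Fin; toℕ; fromℕ)
import Data.Fin as Fin
open import Data.Fin.Patterns using (0F)
open import Data.Fin.Properties using (toℕ-injective; ≤fromℕ)
open import Data.List
  using (List; []; _∷_; length; map; _++_; allFin; concatMap; filter; cartesianProductWith; cartesianProduct)
open import Data.List.Membership.Propositional using (_∈_; lose; find)
open import Data.List.Membership.Propositional.Properties
  using ( ∈-map⁺; ∈-map⁻; ∈-++⁺ˡ; ∈-++⁺ʳ; ∈-++⁻; ∈-allFin; ∈-concatMap⁺; ∈-concatMap⁻; ∈-filter⁺; ∈-filter⁻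
        ; ∈-cartesianProductWith⁺; ∈-cartesianProductWith⁻; ∈-cartesianProduct⁺; ∈-cartesianProduct⁻)
open import Data.List.Properties using (length-map; length-++; length-tabulate; map-cong)
open import Data.List.Relation.Binary.Disjoint.Propositional using (Disjoint)
open import Data.List.Relation.Unary.All using (All; []; _∷_)
import Data.List.Relation.Unary.All as All
import Data.List.Relation.Unary.All.Properties as All
open import Data.List.Relation.Unary.AllPairs using (AllPairs; []; _∷_)
import Data.List.Relation.Unary.AllPairs as AllPairs
import Data.List.Relation.Unary.AllPairs.Properties as AllPairs
open import Data.List.Relation.Unary.Any using (Any; here; there)
import Data.List.Relation.Unary.Any.Properties as Any
open import Data.List.Relation.Unary.Unique.Propositional using (Unique)
import Data.List.Relation.Unary.Unique.Propositional.Properties as Unique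
open import Data.Nat using (ℕ; zero; suc; _+_; _*_; _^_; _≤_; _⊔_; _⊓_; _≤ᵇ_; z≤n; s≤s)
open import Data.Nat.ListAction using (sum)
open import Data.Nat.Properties
open import Data.Nat.Solver using (module +-*-Solver)
open import Data.Nat.Tactic.RingSolver using (solve-∀)
open import Data.Product using (Σ; _×_; _,_; proj₁; proj₂)
open import Data.Sum using (inj₁; inj₂)
open import Data.Unit using (tt)
open import Function using (_∘_)
open import Relation.Binary.PropositionalEquality hiding (J)
open import Relation.Nullary using (¬_)
open import Relation.Nullary.Decidable using (Dec; map′; _→-dec_; _×-dec_; from-yes; T?)
open import Relation.Nullary.Reflects using (ofʸ; ofⁿ)
import Algebra.Properties.CommutativeSemigroup as CommutativeSemigroupProperties
open ≡-Reasoning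

length-cartesianProductWith : ∀ {A B C : Set} (g : A → B → C) xs ys →
                              length (cartesianProductWith g xs ys) ≡ length xs * length ys
length-cartesianProductWith g [] ys = refl
length-cartesianProductWith g (x ∷ xs) ys = begin
  length (map (g x) ys ++ cartesianProductWith g xs ys)
    ≡⟨ length-++ (map (g x) ys) ⟩
  length (map (g x) ys) + length (cartesianProductWith g xs ys)
    ≡⟨ cong₂ _+_ (length-map (g x) ys) (length-cartesianProductWith g xs ys) ⟩
  length ys + length xs * length ys
    ∎

length-concatMap : ∀ {A B : Set} (F : A → List B) xs → length (concatMap F xs) ≡ sum (map (length ∘ F) xs)
length-concatMap F [] = refl
length-concatMap F (x ∷ xs) = trans (length-++ (F x)) (cong (length (F x) +_) (length-concatMap F xs))

concatMap-unique : ∀ {A B : Set} {F : A → List B} (label : B → A) → (∀ {a b} → b ∈ F a → label b ≡ a) →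
                   (∀ a → Unique (F a)) → ∀ {as} → Unique as → Unique (concatMap F as)
concatMap-unique {F = F} label label-F F! {as} as! =
  Unique.concat⁺ (All.map⁺ (All.universal F! as)) (AllPairs.map⁺ (AllPairs.map disjoint as!))
  where
  disjoint : ∀ {a a′} → a ≢ a′ → Disjoint (F a) (F a′)
  disjoint a≢a′ (b∈ , b∈′) = a≢a′ (trans (sym (label-F b∈)) (label-F b∈′))

length-allFin : ∀ n → length (allFin n) ≡ n
length-allFin n = length-tabulate (λ i → i)

both : ∀ {A B : Set} → (A → B) → A × A → B × B
both g (x , y) = g x , g y

-- FOUR and the knowledge order

Four : Set
Four = J 0

kind : ∀ {n} → J n → Four
kind top = top
kind bot = bot
kind (f _) = f 0F
kind (t _) = t 0F

four : List Four
four = top ∷ bot ∷ f 0F ∷ t 0F ∷ []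

∈-four : ∀ k → k ∈ four
∈-four top = here refl
∈-four bot = there (here refl)
∈-four (f 0F) = there (there (here refl))
∈-four (t 0F) = there (there (there (here refl)))

four-unique : Unique four
four-unique = ((λ ()) ∷ (λ ()) ∷ (λ ()) ∷ []) ∷ ((λ ()) ∷ (λ ()) ∷ []) ∷ ((λ ()) ∷ []) ∷ [] ∷ []

∀? : {P : Four → Set} → (∀ k → Dec (P k)) → Dec (∀ k → P k)
∀? P? = map′ (λ all k → All.lookup all (∈-four k)) (λ all → All.tabulate (λ {k} _ → all k)) (All.all? P? four)

infix 4 _≤ₖᵇ_ _≤ₖ_ _≤ₖ?_

_≤ₖᵇ_ : Four → Four → Bool
bot ≤ₖᵇ _ = true
_ ≤ₖᵇ top = true
f _ ≤ₖᵇ f _ = true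
t _ ≤ₖᵇ t _ = true
_ ≤ₖᵇ _ = false

_≤ₖ_ : Four → Four → Set
x ≤ₖ y = T (x ≤ₖᵇ y)

_≤ₖ?_ : ∀ x y → Dec (x ≤ₖ y)
x ≤ₖ? y = T? (x ≤ₖᵇ y)

≤ₖ-refl : ∀ k → k ≤ₖ k
≤ₖ-refl top = tt
≤ₖ-refl bot = tt
≤ₖ-refl (f 0F) = tt
≤ₖ-refl (t 0F) = tt

≤ₖ-trans : ∀ a b c → a ≤ₖ b → b ≤ₖ c → a ≤ₖ c
≤ₖ-trans = from-yes (∀? λ a → ∀? λ b → ∀? λ c → a ≤ₖ? b →-dec b ≤ₖ? c →-dec a ≤ₖ? c)

≤ₖ-⊗⁺ : ∀ x a b → x ≤ₖ a → x ≤ₖ b → x ≤ₖ a ⊗ b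
≤ₖ-⊗⁺ = from-yes (∀? λ x → ∀? λ a → ∀? λ b → x ≤ₖ? a →-dec x ≤ₖ? b →-dec x ≤ₖ? a ⊗ b)

≤ₖ-⊗⁻ : ∀ x a b → x ≤ₖ a ⊗ b → x ≤ₖ a × x ≤ₖ b
≤ₖ-⊗⁻ = from-yes (∀? λ x → ∀? λ a → ∀? λ b → x ≤ₖ? a ⊗ b →-dec x ≤ₖ? a ×-dec x ≤ₖ? b)

⊕-≤ₖ⁺ : ∀ x a b → a ≤ₖ x → b ≤ₖ x → a ⊕ b ≤ₖ x
⊕-≤ₖ⁺ = from-yes (∀? λ x → ∀? λ a → ∀? λ b → a ≤ₖ? x →-dec b ≤ₖ? x →-dec a ⊕ b ≤ₖ? x)

⊕-≤ₖ⁻ : ∀ x a b → a ⊕ b ≤ₖ x → a ≤ₖ x × b ≤ₖ x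
⊕-≤ₖ⁻ = from-yes (∀? λ x → ∀? λ a → ∀? λ b → a ⊕ b ≤ₖ? x →-dec a ≤ₖ? x ×-dec b ≤ₖ? x)

Monotoneₖ₂ : (Four → Four → Four) → Set
Monotoneₖ₂ _∙_ = ∀ a b c d → a ≤ₖ b → c ≤ₖ d → a ∙ c ≤ₖ b ∙ d

monotoneₖ₂? : ∀ _∙_ → Dec (Monotoneₖ₂ _∙_)
monotoneₖ₂? _∙_ = ∀? λ a → ∀? λ b → ∀? λ c → ∀? λ d → a ≤ₖ? b →-dec c ≤ₖ? d →-dec a ∙ c ≤ₖ? b ∙ d

⊗-monoₖ : Monotoneₖ₂ _⊗_
⊗-monoₖ = from-yes (monotoneₖ₂? _⊗_)

⊕-monoₖ : Monotoneₖ₂ _⊕_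
⊕-monoₖ = from-yes (monotoneₖ₂? _⊕_)

∧-monoₖ : Monotoneₖ₂ _∧_
∧-monoₖ = from-yes (monotoneₖ₂? _∧_)

∨-monoₖ : Monotoneₖ₂ _∨_
∨-monoₖ = from-yes (monotoneₖ₂? _∨_)

neg-monoₖ : ∀ a b → a ≤ₖ b → neg a ≤ₖ neg b
neg-monoₖ = from-yes (∀? λ a → ∀? λ b → a ≤ₖ? b →-dec neg a ≤ₖ? neg b)

toℕ-maxF : ∀ {m} (i j : Fin m) → toℕ (maxF i j) ≡ toℕ i ⊔ toℕ j
toℕ-maxF i j with toℕ i ≤ᵇ toℕ j | ≤ᵇ-reflects-≤ (toℕ i) (toℕ j)
... | true  | ofʸ i≤j = sym (m≤n⇒m⊔n≡n i≤j)
... | false | ofⁿ i≰j = sym (m≥n⇒m⊔n≡m (≰⇒≥ i≰j))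

toℕ-minF : ∀ {m} (i j : Fin m) → toℕ (minF i j) ≡ toℕ i ⊓ toℕ j
toℕ-minF i j with toℕ i ≤ᵇ toℕ j | ≤ᵇ-reflects-≤ (toℕ i) (toℕ j)
... | true  | ofʸ i≤j = sym (m≤n⇒m⊓n≡m i≤j)
... | false | ofⁿ i≰j = sym (m≥n⇒m⊓n≡n (≰⇒≥ i≰j))

maxF-mono : ∀ {m} {a b a′ b′ : Fin m} → a Fin.≤ b → a′ Fin.≤ b′ → maxF a a′ Fin.≤ maxF b b′
maxF-mono {a = a} {b} {a′} {b′} a≤b a′≤b′ =
  subst₂ _≤_ (sym (toℕ-maxF a a′)) (sym (toℕ-maxF b b′)) (⊔-mono-≤ a≤b a′≤b′)

minF-mono : ∀ {m} {a b a′ b′ : Fin m} → a Fin.≤ b → a′ Fin.≤ b′ → minF a a′ Fin.≤ minF b b′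
minF-mono {a = a} {b} {a′} {b′} a≤b a′≤b′ =
  subst₂ _≤_ (sym (toℕ-minF a a′)) (sym (toℕ-minF b b′)) (⊓-mono-≤ a≤b a′≤b′)

maxF-lastʳ : ∀ {n} (a : Fin (suc n)) → maxF a (fromℕ n) ≡ fromℕ n
maxF-lastʳ a = toℕ-injective (trans (toℕ-maxF a _) (m≤n⇒m⊔n≡n (≤fromℕ a)))

minF-lastˡ : ∀ {n} (a : Fin (suc n)) → minF (fromℕ n) a ≡ a
minF-lastˡ a = toℕ-injective (trans (toℕ-minF _ a) (m≥n⇒m⊓n≡n (≤fromℕ a)))

⊔-⊓-modular : ∀ {a b} i → a ≤ b → a ⊔ i ⊓ b ≡ (a ⊔ i) ⊓ b
⊔-⊓-modular {a} {b} i a≤b = trans (⊔-distribˡ-⊓ a i b) (cong ((a ⊔ i) ⊓_) (m≤n⇒m⊔n≡n a≤b))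

⊔-clamp : ∀ a b a′ b′ i → (a ⊔ i ⊓ b) ⊔ (a′ ⊔ i ⊓ b′) ≡ (a ⊔ a′) ⊔ i ⊓ (b ⊔ b′)
⊔-clamp a b a′ b′ i = begin
  (a ⊔ i ⊓ b) ⊔ (a′ ⊔ i ⊓ b′) ≡⟨ interchange a (i ⊓ b) a′ (i ⊓ b′) ⟩
  (a ⊔ a′) ⊔ (i ⊓ b ⊔ i ⊓ b′) ≡⟨ cong ((a ⊔ a′) ⊔_) (⊓-distribˡ-⊔ i b b′) ⟨
  (a ⊔ a′) ⊔ i ⊓ (b ⊔ b′)     ∎
  where open CommutativeSemigroupProperties ⊔-commutativeSemigroup using (interchange)

⊓-clamp : ∀ {a b a′ b′} i → a ≤ b → a′ ≤ b′ → (a ⊔ i ⊓ b) ⊓ (a′ ⊔ i ⊓ b′) ≡ (a ⊓ a′) ⊔ i ⊓ (b ⊓ b′)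
⊓-clamp {a} {b} {a′} {b′} i a≤b a′≤b′ = begin
  (a ⊔ i ⊓ b) ⊓ (a′ ⊔ i ⊓ b′)     ≡⟨ cong₂ _⊓_ (⊔-⊓-modular i a≤b) (⊔-⊓-modular i a′≤b′) ⟩
  ((a ⊔ i) ⊓ b) ⊓ ((a′ ⊔ i) ⊓ b′) ≡⟨ interchange (a ⊔ i) b (a′ ⊔ i) b′ ⟩
  ((a ⊔ i) ⊓ (a′ ⊔ i)) ⊓ (b ⊓ b′) ≡⟨ cong (_⊓ (b ⊓ b′)) (⊔-distribʳ-⊓ i a a′) ⟨
  (a ⊓ a′ ⊔ i) ⊓ (b ⊓ b′)         ≡⟨ ⊔-⊓-modular i (⊓-mono-≤ a≤b a′≤b′) ⟨
  (a ⊓ a′) ⊔ i ⊓ (b ⊓ b′)         ∎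
  where open CommutativeSemigroupProperties ⊓-commutativeSemigroup using (interchange)

clamp : ∀ {m} → Fin m → Fin m → Fin m → Fin m
clamp a b i = maxF a (minF i b)

toℕ-clamp : ∀ {m} (a b i : Fin m) → toℕ (clamp a b i) ≡ toℕ a ⊔ toℕ i ⊓ toℕ b
toℕ-clamp a b i = trans (toℕ-maxF a (minF i b)) (cong (toℕ a ⊔_) (toℕ-minF i b))

maxF-clamp : ∀ {m} (a b a′ b′ i : Fin m) →
             maxF (clamp a b i) (clamp a′ b′ i) ≡ clamp (maxF a a′) (maxF b b′) i
maxF-clamp a b a′ b′ i = toℕ-injective (begin
  toℕ (maxF (clamp a b i) (clamp a′ b′ i))            ≡⟨ toℕ-maxF (clamp a b i) (clamp a′ b′ i) ⟩
  toℕ (clamp a b i) ⊔ toℕ (clamp a′ b′ i)             ≡⟨ cong₂ _⊔_ (toℕ-clamp a b i) (toℕ-clamp a′ b′ i) ⟩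
  (toℕ a ⊔ toℕ i ⊓ toℕ b) ⊔ (toℕ a′ ⊔ toℕ i ⊓ toℕ b′) ≡⟨ ⊔-clamp (toℕ a) (toℕ b) (toℕ a′) (toℕ b′) (toℕ i) ⟩
  (toℕ a ⊔ toℕ a′) ⊔ toℕ i ⊓ (toℕ b ⊔ toℕ b′)
    ≡⟨ cong₂ (λ x y → x ⊔ toℕ i ⊓ y) (toℕ-maxF a a′) (toℕ-maxF b b′) ⟨
  toℕ (maxF a a′) ⊔ toℕ i ⊓ toℕ (maxF b b′)           ≡⟨ toℕ-clamp (maxF a a′) (maxF b b′) i ⟨
  toℕ (clamp (maxF a a′) (maxF b b′) i)               ∎)

minF-clamp : ∀ {m} {a b a′ b′ : Fin m} i → a Fin.≤ b → a′ Fin.≤ b′ →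
             minF (clamp a b i) (clamp a′ b′ i) ≡ clamp (minF a a′) (minF b b′) i
minF-clamp {a = a} {b} {a′} {b′} i a≤b a′≤b′ = toℕ-injective (begin
  toℕ (minF (clamp a b i) (clamp a′ b′ i))            ≡⟨ toℕ-minF (clamp a b i) (clamp a′ b′ i) ⟩
  toℕ (clamp a b i) ⊓ toℕ (clamp a′ b′ i)             ≡⟨ cong₂ _⊓_ (toℕ-clamp a b i) (toℕ-clamp a′ b′ i) ⟩
  (toℕ a ⊔ toℕ i ⊓ toℕ b) ⊓ (toℕ a′ ⊔ toℕ i ⊓ toℕ b′) ≡⟨ ⊓-clamp (toℕ i) a≤b a′≤b′ ⟩
  (toℕ a ⊓ toℕ a′) ⊔ toℕ i ⊓ (toℕ b ⊓ toℕ b′)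
    ≡⟨ cong₂ (λ x y → x ⊔ toℕ i ⊓ y) (toℕ-minF a a′) (toℕ-minF b b′) ⟨
  toℕ (minF a a′) ⊔ toℕ i ⊓ toℕ (minF b b′)           ≡⟨ toℕ-clamp (minF a a′) (minF b b′) i ⟨
  toℕ (clamp (minF a a′) (minF b b′) i)               ∎)

clamp-same : ∀ {m} (a i : Fin m) → clamp a a i ≡ a
clamp-same a i = toℕ-injective (trans (toℕ-clamp a a i)
  (trans (cong (toℕ a ⊔_) (⊓-comm (toℕ i) (toℕ a))) (⊔-absorbs-⊓ (toℕ a) (toℕ i))))

clamp-identity : ∀ {n} (i : Fin (suc n)) → clamp 0F (fromℕ n) i ≡ i
clamp-identity {n} i = toℕ-injective (trans (toℕ-clamp 0F (fromℕ n) i) (m≤n⇒m⊓n≡m (≤fromℕ i)))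

clamp-zero : ∀ {n} (a b : Fin (suc n)) → clamp a b 0F ≡ a
clamp-zero a b = toℕ-injective (trans (toℕ-maxF a 0F) (⊔-identityʳ (toℕ a)))

clamp-last : ∀ {n} {a b : Fin (suc n)} → a Fin.≤ b → clamp a b (fromℕ n) ≡ b
clamp-last {n} {a} {b} a≤b = toℕ-injective (begin
  toℕ (clamp a b (fromℕ n))     ≡⟨ toℕ-clamp a b (fromℕ n) ⟩
  toℕ a ⊔ toℕ (fromℕ n) ⊓ toℕ b ≡⟨ cong (toℕ a ⊔_) (m≥n⇒m⊓n≡n (≤fromℕ b)) ⟩
  toℕ a ⊔ toℕ b                 ≡⟨ m≤n⇒m⊔n≡n a≤b ⟩
  toℕ b                         ∎)

data Segment {n} : J n → J n → Set where
  bot-bot : Segment bot bot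
  top-top : Segment top top
  f≤f : ∀ {a b} → a Fin.≤ b → Segment (f a) (f b)
  t≤t : ∀ {a b} → a Fin.≤ b → Segment (t a) (t b)

segment : ∀ {n} → J n → J n → Fin (suc n) → J n
segment (f a) (f b) i = f (clamp a b i)
segment (t a) (t b) i = t (clamp a b i)
segment p _ _ = p

segment-kind : ∀ {n} {p q : J n} → Segment p q → kind q ≡ kind p
segment-kind bot-bot = refl
segment-kind top-top = refl
segment-kind (f≤f _) = refl
segment-kind (t≤t _) = refl

segment-same : ∀ {n} (p : J n) → Segment p p × (∀ i → p ≡ segment p p i)
segment-same top = top-top , λ _ → refl
segment-same bot = bot-bot , λ _ → refl
segment-same (f a) = f≤f ≤-refl , λ i → sym (cong f (clamp-same a i))
segment-same (t a) = t≤t ≤-refl , λ i → sym (cong t (clamp-same a i))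

PreservesSegments : (∀ {n} → J n → J n → J n) → Set
PreservesSegments _∙_ = ∀ {n} {p q p′ q′ : J n} → Segment p q → Segment p′ q′ →
  Segment (p ∙ p′) (q ∙ q′) × (∀ i → segment p q i ∙ segment p′ q′ i ≡ segment (p ∙ p′) (q ∙ q′) i)

⊗-segments : PreservesSegments _⊗_
⊗-segments bot-bot _ = bot-bot , λ _ → refl
⊗-segments top-top s = s , λ _ → refl
⊗-segments (f≤f _) bot-bot = bot-bot , λ _ → refl
⊗-segments (f≤f a≤b) top-top = f≤f a≤b , λ _ → refl
⊗-segments (f≤f {a} {b} a≤b) (f≤f {a′} {b′} a′≤b′) =
  f≤f (maxF-mono a≤b a′≤b′) , λ i → cong f (maxF-clamp a b a′ b′ i)
⊗-segments (f≤f _) (t≤t _) = bot-bot , λ _ → refl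
⊗-segments (t≤t _) bot-bot = bot-bot , λ _ → refl
⊗-segments (t≤t a≤b) top-top = t≤t a≤b , λ _ → refl
⊗-segments (t≤t _) (f≤f _) = bot-bot , λ _ → refl
⊗-segments (t≤t {a} {b} a≤b) (t≤t {a′} {b′} a′≤b′) =
  t≤t (maxF-mono a≤b a′≤b′) , λ i → cong t (maxF-clamp a b a′ b′ i)

⊕-segments : PreservesSegments _⊕_
⊕-segments bot-bot s = s , λ _ → refl
⊕-segments top-top _ = top-top , λ _ → refl
⊕-segments (f≤f a≤b) bot-bot = f≤f a≤b , λ _ → refl
⊕-segments (f≤f _) top-top = top-top , λ _ → refl
⊕-segments (f≤f a≤b) (f≤f a′≤b′) = f≤f (minF-mono a≤b a′≤b′) , λ i → cong f (minF-clamp i a≤b a′≤b′)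
⊕-segments (f≤f _) (t≤t _) = top-top , λ _ → refl
⊕-segments (t≤t a≤b) bot-bot = t≤t a≤b , λ _ → refl
⊕-segments (t≤t _) top-top = top-top , λ _ → refl
⊕-segments (t≤t _) (f≤f _) = top-top , λ _ → refl
⊕-segments (t≤t a≤b) (t≤t a′≤b′) = t≤t (minF-mono a≤b a′≤b′) , λ i → cong t (minF-clamp i a≤b a′≤b′)

∧-segments : PreservesSegments _∧_
∧-segments bot-bot bot-bot = bot-bot , λ _ → refl
∧-segments bot-bot top-top = segment-same _
∧-segments bot-bot (f≤f a≤b) = f≤f a≤b , λ _ → refl
∧-segments bot-bot (t≤t _) = bot-bot , λ _ → refl
∧-segments top-top bot-bot = segment-same _
∧-segments top-top top-top = top-top , λ _ → refl
∧-segments top-top (f≤f a≤b) = f≤f a≤b , λ _ → refl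
∧-segments top-top (t≤t _) = top-top , λ _ → refl
∧-segments (f≤f a≤b) (f≤f a′≤b′) = f≤f (minF-mono a≤b a′≤b′) , λ i → cong f (minF-clamp i a≤b a′≤b′)
∧-segments (f≤f a≤b) bot-bot = f≤f a≤b , λ _ → refl
∧-segments (f≤f a≤b) top-top = f≤f a≤b , λ _ → refl
∧-segments (f≤f a≤b) (t≤t _) = f≤f a≤b , λ _ → refl
∧-segments (t≤t _) (f≤f a≤b) = f≤f a≤b , λ _ → refl
∧-segments (t≤t {a} {b} a≤b) (t≤t {a′} {b′} a′≤b′) =
  t≤t (maxF-mono a≤b a′≤b′) , λ i → cong t (maxF-clamp a b a′ b′ i)
∧-segments (t≤t _) bot-bot = bot-bot , λ _ → refl
∧-segments (t≤t _) top-top = top-top , λ _ → refl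

∨-segments : PreservesSegments _∨_
∨-segments bot-bot bot-bot = bot-bot , λ _ → refl
∨-segments bot-bot top-top = segment-same _
∨-segments bot-bot (f≤f _) = bot-bot , λ _ → refl
∨-segments bot-bot (t≤t a≤b) = t≤t a≤b , λ _ → refl
∨-segments top-top bot-bot = segment-same _
∨-segments top-top top-top = top-top , λ _ → refl
∨-segments top-top (f≤f _) = top-top , λ _ → refl
∨-segments top-top (t≤t a≤b) = t≤t a≤b , λ _ → refl
∨-segments (t≤t a≤b) (t≤t a′≤b′) = t≤t (minF-mono a≤b a′≤b′) , λ i → cong t (minF-clamp i a≤b a′≤b′)
∨-segments (t≤t a≤b) bot-bot = t≤t a≤b , λ _ → refl
∨-segments (t≤t a≤b) top-top = t≤t a≤b , λ _ → refl
∨-segments (t≤t a≤b) (f≤f _) = t≤t a≤b , λ _ → refl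
∨-segments (f≤f _) (t≤t a≤b) = t≤t a≤b , λ _ → refl
∨-segments (f≤f {a} {b} a≤b) (f≤f {a′} {b′} a′≤b′) =
  f≤f (maxF-mono a≤b a′≤b′) , λ i → cong f (maxF-clamp a b a′ b′ i)
∨-segments (f≤f _) bot-bot = bot-bot , λ _ → refl
∨-segments (f≤f _) top-top = top-top , λ _ → refl

neg-segments : ∀ {n} {p q : J n} → Segment p q →
               Segment (neg p) (neg q) × (∀ i → neg (segment p q i) ≡ segment (neg p) (neg q) i)
neg-segments bot-bot = bot-bot , λ _ → refl
neg-segments top-top = top-top , λ _ → refl
neg-segments (f≤f a≤b) = t≤t a≤b , λ _ → refl
neg-segments (t≤t a≤b) = f≤f a≤b , λ _ → refl

-- Codes of unary term operations

record Code (n : ℕ) : Set where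
  constructor code
  field
    atTop atBot atF₀ atFₙ atT₀ atTₙ : J n
open Code

code-cong : ∀ {n} {T T′ B B′ p p′ q q′ r r′ s s′ : J n} →
            T ≡ T′ → B ≡ B′ → p ≡ p′ → q ≡ q′ → r ≡ r′ → s ≡ s′ → code T B p q r s ≡ code T′ B′ p′ q′ r′ s′
code-cong refl refl refl refl refl refl = refl

encode : ∀ {n} → (J n → J n) → Code n
encode {n} g = code (g top) (g bot) (g (f 0F)) (g (f (fromℕ n))) (g (t 0F)) (g (t (fromℕ n)))

decode : ∀ {n} → Code n → J n → J n
decode c top = atTop c
decode c bot = atBot c
decode c (f i) = segment (atF₀ c) (atFₙ c) i
decode c (t i) = segment (atT₀ c) (atTₙ c) i

record Valid {n} (c : Code n) : Set where
  field
    f-segment : Segment (atF₀ c) (atFₙ c)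
    t-segment : Segment (atT₀ c) (atTₙ c)
    bot≤f₀ : kind (atBot c) ≤ₖ kind (atF₀ c)
    bot≤t₀ : kind (atBot c) ≤ₖ kind (atT₀ c)
    f₀≤top : kind (atF₀ c) ≤ₖ kind (atTop c)
    t₀≤top : kind (atT₀ c) ≤ₖ kind (atTop c)
open Valid

Encodable : ∀ {n} → (J n → J n) → Set
Encodable g = Valid (encode g) × (∀ x → g x ≡ decode (encode g) x)

zipCode : ∀ {n} → (J n → J n → J n) → Code n → Code n → Code n
zipCode _∙_ c c′ = code (atTop c ∙ atTop c′) (atBot c ∙ atBot c′)
  (atF₀ c ∙ atF₀ c′) (atFₙ c ∙ atFₙ c′) (atT₀ c ∙ atT₀ c′) (atTₙ c ∙ atTₙ c′)

mapCode : ∀ {n} → (J n → J n) → Code n → Code n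
mapCode h c = code (h (atTop c)) (h (atBot c)) (h (atF₀ c)) (h (atFₙ c)) (h (atT₀ c)) (h (atTₙ c))

record Compatible (_∙_ : ∀ {n} → J n → J n → J n) : Set where
  field
    kind-hom : ∀ {n} (x y : J n) → kind (x ∙ y) ≡ kind x ∙ kind y
    monoₖ : Monotoneₖ₂ _∙_
    preservesSegments : PreservesSegments _∙_

  kind-mono : ∀ {n} {x y x′ y′ : J n} → kind x ≤ₖ kind y → kind x′ ≤ₖ kind y′ →
              kind (x ∙ x′) ≤ₖ kind (y ∙ y′)
  kind-mono {x = x} {y} {x′} {y′} x≤y x′≤y′ =
    subst₂ _≤ₖ_ (sym (kind-hom x x′)) (sym (kind-hom y y′)) (monoₖ _ _ _ _ x≤y x′≤y′)

  valid-zip : ∀ {n} {c c′ : Code n} → Valid c → Valid c′ → Valid (zipCode _∙_ c c′)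
  valid-zip v v′ = record
    { f-segment = proj₁ (preservesSegments (f-segment v) (f-segment v′))
    ; t-segment = proj₁ (preservesSegments (t-segment v) (t-segment v′))
    ; bot≤f₀ = kind-mono (bot≤f₀ v) (bot≤f₀ v′)
    ; bot≤t₀ = kind-mono (bot≤t₀ v) (bot≤t₀ v′)
    ; f₀≤top = kind-mono (f₀≤top v) (f₀≤top v′)
    ; t₀≤top = kind-mono (t₀≤top v) (t₀≤top v′)
    }

  decode-zip : ∀ {n} {c c′ : Code n} → Valid c → Valid c′ →
               ∀ x → decode c x ∙ decode c′ x ≡ decode (zipCode _∙_ c c′) x
  decode-zip v v′ top = refl
  decode-zip v v′ bot = refl
  decode-zip v v′ (f i) = proj₂ (preservesSegments (f-segment v) (f-segment v′)) i
  decode-zip v v′ (t i) = proj₂ (preservesSegments (t-segment v) (t-segment v′)) i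

  -- Here encode (λ x → g x ∙ h x) reduces to zipCode _∙_ (encode g) (encode h).
  encodable : ∀ {n} {g h : J n → J n} → Encodable g → Encodable h → Encodable (λ x → g x ∙ h x)
  encodable (vg , g≗) (vh , h≗) =
    valid-zip vg vh , λ x → trans (cong₂ _∙_ (g≗ x) (h≗ x)) (decode-zip vg vh x)

⊗-compatible : Compatible _⊗_
⊗-compatible = record { kind-hom = kind-⊗ ; monoₖ = ⊗-monoₖ ; preservesSegments = ⊗-segments }
  where
  kind-⊗ : ∀ {n} (x y : J n) → kind (x ⊗ y) ≡ kind x ⊗ kind y
  kind-⊗ top y = refl
  kind-⊗ bot y = refl
  kind-⊗ (f i) top = refl
  kind-⊗ (f i) bot = refl
  kind-⊗ (f i) (f j) = refl
  kind-⊗ (f i) (t j) = refl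
  kind-⊗ (t i) top = refl
  kind-⊗ (t i) bot = refl
  kind-⊗ (t i) (f j) = refl
  kind-⊗ (t i) (t j) = refl

⊕-compatible : Compatible _⊕_
⊕-compatible = record { kind-hom = kind-⊕ ; monoₖ = ⊕-monoₖ ; preservesSegments = ⊕-segments }
  where
  kind-⊕ : ∀ {n} (x y : J n) → kind (x ⊕ y) ≡ kind x ⊕ kind y
  kind-⊕ bot y = refl
  kind-⊕ top y = refl
  kind-⊕ (f i) top = refl
  kind-⊕ (f i) bot = refl
  kind-⊕ (f i) (f j) = refl
  kind-⊕ (f i) (t j) = refl
  kind-⊕ (t i) top = refl
  kind-⊕ (t i) bot = refl
  kind-⊕ (t i) (f j) = refl
  kind-⊕ (t i) (t j) = refl

∧-compatible : Compatible _∧_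
∧-compatible = record { kind-hom = kind-∧ ; monoₖ = ∧-monoₖ ; preservesSegments = ∧-segments }
  where
  kind-∧ : ∀ {n} (x y : J n) → kind (x ∧ y) ≡ kind x ∧ kind y
  kind-∧ (f i) (f j) = refl
  kind-∧ (f i) (t j) = refl
  kind-∧ (f i) top = refl
  kind-∧ (f i) bot = refl
  kind-∧ (t i) (f j) = refl
  kind-∧ (t i) (t j) = refl
  kind-∧ (t i) top = refl
  kind-∧ (t i) bot = refl
  kind-∧ top (f j) = refl
  kind-∧ top (t j) = refl
  kind-∧ top top = refl
  kind-∧ top bot = refl
  kind-∧ bot (f j) = refl
  kind-∧ bot (t j) = refl
  kind-∧ bot top = refl
  kind-∧ bot bot = refl

∨-compatible : Compatible _∨_
∨-compatible = record { kind-hom = kind-∨ ; monoₖ = ∨-monoₖ ; preservesSegments = ∨-segments }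
  where
  kind-∨ : ∀ {n} (x y : J n) → kind (x ∨ y) ≡ kind x ∨ kind y
  kind-∨ (f i) (f j) = refl
  kind-∨ (f i) (t j) = refl
  kind-∨ (f i) top = refl
  kind-∨ (f i) bot = refl
  kind-∨ (t i) (f j) = refl
  kind-∨ (t i) (t j) = refl
  kind-∨ (t i) top = refl
  kind-∨ (t i) bot = refl
  kind-∨ top (f j) = refl
  kind-∨ top (t j) = refl
  kind-∨ top top = refl
  kind-∨ top bot = refl
  kind-∨ bot (f j) = refl
  kind-∨ bot (t j) = refl
  kind-∨ bot top = refl
  kind-∨ bot bot = refl

kind-neg : ∀ {n} (x : J n) → kind (neg x) ≡ neg (kind x)
kind-neg top = refl
kind-neg bot = refl
kind-neg (f i) = refl
kind-neg (t i) = refl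

encodable-neg : ∀ {n} {g : J n → J n} → Encodable g → Encodable (λ x → neg (g x))
encodable-neg {g = g} (v , g≗) = valid , λ x → trans (cong neg (g≗ x)) (decode-neg x)
  where
  kind-mono : ∀ {x y} → kind x ≤ₖ kind y → kind (neg x) ≤ₖ kind (neg y)
  kind-mono {x} {y} x≤y = subst₂ _≤ₖ_ (sym (kind-neg x)) (sym (kind-neg y)) (neg-monoₖ _ _ x≤y)
  valid : Valid (mapCode neg (encode g))
  valid = record
    { f-segment = proj₁ (neg-segments (f-segment v))
    ; t-segment = proj₁ (neg-segments (t-segment v))
    ; bot≤f₀ = kind-mono (bot≤f₀ v)
    ; bot≤t₀ = kind-mono (bot≤t₀ v)
    ; f₀≤top = kind-mono (f₀≤top v)
    ; t₀≤top = kind-mono (t₀≤top v)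
    }
  decode-neg : ∀ x → neg (decode (encode g) x) ≡ decode (mapCode neg (encode g)) x
  decode-neg top = refl
  decode-neg bot = refl
  decode-neg (f i) = proj₂ (neg-segments (f-segment v)) i
  decode-neg (t i) = proj₂ (neg-segments (t-segment v)) i

encodable-id : ∀ {n} → Encodable {n} (λ x → x)
encodable-id {n} = valid , id≗
  where
  valid : Valid (encode {n} (λ x → x))
  valid = record { f-segment = f≤f z≤n ; t-segment = t≤t z≤n
                 ; bot≤f₀ = tt ; bot≤t₀ = tt ; f₀≤top = tt ; t₀≤top = tt }
  id≗ : ∀ x → x ≡ decode (encode (λ x → x)) x
  id≗ top = refl
  id≗ bot = refl
  id≗ (f i) = sym (cong f (clamp-identity i))
  id≗ (t i) = sym (cong t (clamp-identity i))

encodable-const : ∀ {n} (c : J n) → Encodable (λ _ → c)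
encodable-const c = valid , const≗
  where
  valid : Valid (encode (λ _ → c))
  valid = record { f-segment = proj₁ (segment-same c) ; t-segment = proj₁ (segment-same c)
                 ; bot≤f₀ = ≤ₖ-refl (kind c) ; bot≤t₀ = ≤ₖ-refl (kind c)
                 ; f₀≤top = ≤ₖ-refl (kind c) ; t₀≤top = ≤ₖ-refl (kind c) }
  const≗ : ∀ x → c ≡ decode (encode (λ _ → c)) x
  const≗ top = refl
  const≗ bot = refl
  const≗ (f i) = proj₂ (segment-same c) i
  const≗ (t i) = proj₂ (segment-same c) i

⟦⟧-encodable : ∀ {n} (u : Term n) → Encodable ⟦ u ⟧
⟦⟧-encodable var = encodable-id
⟦⟧-encodable (con c) = encodable-const c
⟦⟧-encodable (s ⊗ₜ u) = Compatible.encodable ⊗-compatible (⟦⟧-encodable s) (⟦⟧-encodable u)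
⟦⟧-encodable (s ⊕ₜ u) = Compatible.encodable ⊕-compatible (⟦⟧-encodable s) (⟦⟧-encodable u)
⟦⟧-encodable (s ∧ₜ u) = Compatible.encodable ∧-compatible (⟦⟧-encodable s) (⟦⟧-encodable u)
⟦⟧-encodable (s ∨ₜ u) = Compatible.encodable ∨-compatible (⟦⟧-encodable s) (⟦⟧-encodable u)
⟦⟧-encodable (negₜ s) = encodable-neg (⟦⟧-encodable s)

-- Realizing valid codes by terms

least : ∀ {n} → Four → J n
least top = top
least bot = bot
least {n} (f _) = f (fromℕ n)
least {n} (t _) = t (fromℕ n)

⊕-identityʳ : ∀ {n} (x : J n) → x ⊕ bot ≡ x
⊕-identityʳ top = refl
⊕-identityʳ bot = refl
⊕-identityʳ (f _) = refl
⊕-identityʳ (t _) = refl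

least-⊕ : ∀ {n} {k} (v : J n) → k ≤ₖ kind v → least k ⊕ v ≡ v
least-⊕ {k = top} top _ = refl
least-⊕ {k = bot} v _ = refl
least-⊕ {k = f _} top _ = refl
least-⊕ {k = f _} (f i) _ = cong f (minF-lastˡ i)
least-⊕ {k = t _} top _ = refl
least-⊕ {k = t _} (t i) _ = cong t (minF-lastˡ i)

-- On fᵢ the term clampₜ a b var takes the value f (clamp a b i); it is f (fromℕ n) at ⊤
-- and ⊥ elsewhere.
clampₜ : ∀ {n} → Fin (suc n) → Fin (suc n) → Term n → Term n
clampₜ a b y = (con (f a) ⊗ₜ ((y ⊕ₜ con (f b)) ∧ₜ con bot)) ⊗ₜ (con top ∨ₜ y)

segmentₜ : ∀ {n} → J n → J n → Term n → Term n
segmentₜ (f a) (f b) y = clampₜ a b y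
segmentₜ (t a) (t b) y = negₜ (clampₜ a b y)
segmentₜ top _ y = (y ⊗ₜ con (f 0F)) ⊕ₜ (negₜ y ⊗ₜ con (t 0F))
segmentₜ _ _ _ = con bot

botₜ : ∀ {n} → J n → Term n
botₜ (f a) = ((con (f a) ⊕ₜ var) ⊕ₜ negₜ var) ∧ₜ con bot
botₜ (t a) = negₜ (botₜ (f a))
botₜ c = con c

topₜ : ∀ {n} → J n → Term n
topₜ c = (var ⊗ₜ negₜ var) ⊗ₜ con c

-- Each summand has the prescribed values at its own points and, elsewhere, ⊥ or the ⊕-least
-- element of the kind it must not disturb; validity makes these kinds comparable.
realize : ∀ {n} → Code n → Term n
realize c = botₜ (atBot c) ⊕ₜ (segmentₜ (atF₀ c) (atFₙ c) var ⊕ₜ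
              (segmentₜ (atT₀ c) (atTₙ c) (negₜ var) ⊕ₜ topₜ (atTop c)))

encode-segmentₜ-var : ∀ {n} {p q : J n} → Segment p q →
                      encode ⟦ segmentₜ p q var ⟧ ≡ code (least (kind p)) bot p q bot bot
encode-segmentₜ-var bot-bot = refl
encode-segmentₜ-var top-top = refl
encode-segmentₜ-var (f≤f {a} {b} a≤b) =
  code-cong (cong f (maxF-lastʳ a)) refl (cong f (clamp-zero a b)) (cong f (clamp-last a≤b)) refl refl
encode-segmentₜ-var (t≤t {a} {b} a≤b) =
  code-cong (cong t (maxF-lastʳ a)) refl (cong t (clamp-zero a b)) (cong t (clamp-last a≤b)) refl refl

encode-segmentₜ-neg : ∀ {n} {p q : J n} → Segment p q →
                      encode ⟦ segmentₜ p q (negₜ var) ⟧ ≡ code (least (kind p)) bot bot bot p q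
encode-segmentₜ-neg bot-bot = refl
encode-segmentₜ-neg top-top = refl
encode-segmentₜ-neg (f≤f {a} {b} a≤b) =
  code-cong (cong f (maxF-lastʳ a)) refl refl refl (cong f (clamp-zero a b)) (cong f (clamp-last a≤b))
encode-segmentₜ-neg (t≤t {a} {b} a≤b) =
  code-cong (cong t (maxF-lastʳ a)) refl refl refl (cong t (clamp-zero a b)) (cong t (clamp-last a≤b))

encode-botₜ : ∀ {n} (B : J n) → let L = least (kind B) in encode ⟦ botₜ B ⟧ ≡ code L B L L L L
encode-botₜ top = refl
encode-botₜ bot = refl
encode-botₜ (f _) = refl
encode-botₜ (t _) = refl

encode-realize : ∀ {n} {c : Code n} → Valid c → encode ⟦ realize c ⟧ ≡ c
encode-realize {n} {c@(code T B p q r s)} v = begin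
  encode ⟦ realize c ⟧
    ≡⟨ cong₂ (join (encode ⟦ botₜ B ⟧))
             (encode-segmentₜ-var (f-segment v)) (encode-segmentₜ-neg (t-segment v)) ⟩
  join (encode ⟦ botₜ B ⟧) fPart tPart
    ≡⟨ cong (λ e → join e fPart tPart) (encode-botₜ B) ⟩
  join (code L B L L L L) fPart tPart
    ≡⟨ code-cong atTop≡ (⊕-identityʳ B)
                 (absorb p (bot≤f₀ v)) (absorb q B≤q) (absorb r (bot≤t₀ v)) (absorb s B≤s) ⟩
  c ∎
  where
  L : J n
  L = least (kind B)
  fPart tPart : Code n
  fPart = code (least (kind p)) bot p q bot bot
  tPart = code (least (kind r)) bot bot bot r s
  join : Code n → Code n → Code n → Code n
  join e₀ e₁ e₂ = zipCode _⊕_ e₀ (zipCode _⊕_ e₁ (zipCode _⊕_ e₂ (encode ⟦ topₜ T ⟧)))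
  absorb : ∀ x → kind B ≤ₖ kind x → L ⊕ (x ⊕ bot) ≡ x
  absorb x B≤x = trans (cong (L ⊕_) (⊕-identityʳ x)) (least-⊕ x B≤x)
  B≤q : kind B ≤ₖ kind q
  B≤q = subst (kind B ≤ₖ_) (sym (segment-kind (f-segment v))) (bot≤f₀ v)
  B≤s : kind B ≤ₖ kind s
  B≤s = subst (kind B ≤ₖ_) (sym (segment-kind (t-segment v))) (bot≤t₀ v)
  atTop≡ : L ⊕ (least (kind p) ⊕ (least (kind r) ⊕ T)) ≡ T
  atTop≡ = begin
    L ⊕ (least (kind p) ⊕ (least (kind r) ⊕ T))
      ≡⟨ cong (λ x → L ⊕ (least (kind p) ⊕ x)) (least-⊕ T (t₀≤top v)) ⟩
    L ⊕ (least (kind p) ⊕ T)                    ≡⟨ cong (L ⊕_) (least-⊕ T (f₀≤top v)) ⟩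
    L ⊕ T                                       ≡⟨ least-⊕ T (≤ₖ-trans _ _ _ (bot≤f₀ v) (f₀≤top v)) ⟩
    T                                           ∎

≈ₜ⇒encode≡ : ∀ {n} {s u : Term n} → s ≈ₜ u → encode ⟦ s ⟧ ≡ encode ⟦ u ⟧
≈ₜ⇒encode≡ {n} s≈u =
  code-cong (s≈u top) (s≈u bot) (s≈u (f 0F)) (s≈u (f (fromℕ n))) (s≈u (t 0F)) (s≈u (t (fromℕ n)))

realize-encode : ∀ {n} (u : Term n) → realize (encode ⟦ u ⟧) ≈ₜ u
realize-encode u x = begin
  ⟦ realize c ⟧ x                 ≡⟨ proj₂ (⟦⟧-encodable (realize c)) x ⟩
  decode (encode ⟦ realize c ⟧) x ≡⟨ cong (λ e → decode e x) (encode-realize (proj₁ (⟦⟧-encodable u))) ⟩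
  decode c x                      ≡⟨ proj₂ (⟦⟧-encodable u) x ⟨
  ⟦ u ⟧ x                         ∎
  where
  c : Code _
  c = encode ⟦ u ⟧

realize-injective : ∀ {n} {c c′ : Code n} → Valid c → Valid c′ → realize c ≈ₜ realize c′ → c ≡ c′
realize-injective {c = c} {c′} v v′ c≈c′ =
  trans (sym (encode-realize v)) (trans (≈ₜ⇒encode≡ {s = realize c} {realize c′} c≈c′) (encode-realize v′))

realize-distinct : ∀ {n} {cs : List (Code n)} → All Valid cs → Unique cs →
                   AllPairs (λ s u → ¬ s ≈ₜ u) (map realize cs)
realize-distinct [] [] = []
realize-distinct (v ∷ vs) (c∉ ∷ cs!) =
  All.map⁺ (All.zipWith (λ (v′ , c≢c′) c≈c′ → c≢c′ (realize-injective v v′ c≈c′)) (vs , c∉))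
  ∷ realize-distinct vs cs!

ascendingPairs : ∀ m → List (Fin m × Fin m)
ascendingPairs zero = []
ascendingPairs (suc m) = map (0F ,_) (allFin (suc m)) ++ map (both Fin.suc) (ascendingPairs m)

∈-ascendingPairs⁺ : ∀ {m} {a b : Fin m} → a Fin.≤ b → (a , b) ∈ ascendingPairs m
∈-ascendingPairs⁺ {suc m} {0F} {b} _ = ∈-++⁺ˡ (∈-map⁺ (0F ,_) (∈-allFin b))
∈-ascendingPairs⁺ {suc m} {Fin.suc a} {Fin.suc b} (s≤s a≤b) =
  ∈-++⁺ʳ (map (0F ,_) (allFin (suc m))) (∈-map⁺ (both Fin.suc) (∈-ascendingPairs⁺ a≤b))

∈-ascendingPairs⁻ : ∀ {m} {a b : Fin m} → (a , b) ∈ ascendingPairs m → a Fin.≤ b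
∈-ascendingPairs⁻ {suc m} ab∈ with ∈-++⁻ (map (0F ,_) (allFin (suc m))) ab∈
... | inj₁ ab∈₀ with ∈-map⁻ (0F ,_) ab∈₀
...   | _ , _ , refl = z≤n
∈-ascendingPairs⁻ {suc m} ab∈ | inj₂ ab∈₁ with ∈-map⁻ (both Fin.suc) ab∈₁
...   | _ , ab∈′ , refl = s≤s (∈-ascendingPairs⁻ ab∈′)

ascendingPairs-unique : ∀ m → Unique (ascendingPairs m)
ascendingPairs-unique zero = []
ascendingPairs-unique (suc m) =
  Unique.++⁺ (Unique.map⁺ (cong proj₂) (Unique.allFin⁺ (suc m)))
             (Unique.map⁺ both-suc-injective (ascendingPairs-unique m)) disjoint
  where
  both-suc-injective : ∀ {x y : Fin m × Fin m} → both Fin.suc x ≡ both Fin.suc y → x ≡ y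
  both-suc-injective {_ , _} {_ , _} refl = refl
  disjoint : Disjoint (map (0F ,_) (allFin (suc m))) (map (both Fin.suc) (ascendingPairs m))
  disjoint (v∈₀ , v∈₁) with ∈-map⁻ (0F ,_) v∈₀ | ∈-map⁻ (both Fin.suc) v∈₁
  ... | _ , _ , refl | _ , _ , ()

length-ascendingPairs : ∀ m → 2 * length (ascendingPairs m) ≡ m * suc m
length-ascendingPairs zero = refl
length-ascendingPairs (suc m) = begin
  2 * length (starts ++ shifted)            ≡⟨ cong (2 *_) (length-++ starts) ⟩
  2 * (length starts + length shifted)
    ≡⟨ cong₂ (λ x y → 2 * (x + y)) length-starts (length-map (both Fin.suc) (ascendingPairs m)) ⟩
  2 * (suc m + length (ascendingPairs m))   ≡⟨ *-distribˡ-+ 2 (suc m) _ ⟩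
  2 * suc m + 2 * length (ascendingPairs m) ≡⟨ cong (2 * suc m +_) (length-ascendingPairs m) ⟩
  2 * suc m + m * suc m                     ≡⟨ factor m ⟩
  suc m * suc (suc m)                       ∎
  where
  starts shifted : List (Fin (suc m) × Fin (suc m))
  starts = map (0F ,_) (allFin (suc m))
  shifted = map (both Fin.suc) (ascendingPairs m)
  length-starts : length starts ≡ suc m
  length-starts = trans (length-map _ (allFin (suc m))) (length-allFin (suc m))
  factor : ∀ m → 2 * suc m + m * suc m ≡ suc m * suc (suc m)
  factor = solve-∀

fibre : ∀ n → Four → List (J n)
fibre n top = top ∷ []
fibre n bot = bot ∷ []
fibre n (f _) = map f (allFin (suc n))
fibre n (t _) = map t (allFin (suc n))

∈-fibre : ∀ {n} (v : J n) → v ∈ fibre n (kind v)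
∈-fibre top = here refl
∈-fibre bot = here refl
∈-fibre (f i) = ∈-map⁺ f (∈-allFin i)
∈-fibre (t i) = ∈-map⁺ t (∈-allFin i)

fibre-kind : ∀ {n} k {v : J n} → v ∈ fibre n k → kind v ≡ k
fibre-kind top (here refl) = refl
fibre-kind bot (here refl) = refl
fibre-kind (f 0F) v∈ with ∈-map⁻ f v∈
... | _ , _ , refl = refl
fibre-kind (t 0F) v∈ with ∈-map⁻ t v∈
... | _ , _ , refl = refl

fibre-unique : ∀ n k → Unique (fibre n k)
fibre-unique n top = [] ∷ []
fibre-unique n bot = [] ∷ []
fibre-unique n (f _) = Unique.map⁺ (λ { refl → refl }) (Unique.allFin⁺ (suc n))
fibre-unique n (t _) = Unique.map⁺ (λ { refl → refl }) (Unique.allFin⁺ (suc n))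

fibreSize : ℕ → Four → ℕ
fibreSize n top = 1
fibreSize n bot = 1
fibreSize n (f _) = suc n
fibreSize n (t _) = suc n

length-fibre : ∀ n k → length (fibre n k) ≡ fibreSize n k
length-fibre n top = refl
length-fibre n bot = refl
length-fibre n (f _) = trans (length-map f (allFin (suc n))) (length-allFin (suc n))
length-fibre n (t _) = trans (length-map t (allFin (suc n))) (length-allFin (suc n))

module _ {P : Four → Set} (P? : ∀ k → Dec (P k)) where

  elementsWhere : ∀ n → List (J n)
  elementsWhere n = concatMap (fibre n) (filter P? four)

  ∈-elementsWhere⁺ : ∀ {n} {v : J n} → P (kind v) → v ∈ elementsWhere n
  ∈-elementsWhere⁺ {n} {v} Pv =
    ∈-concatMap⁺ (fibre n) {xs = filter P? four} (lose (∈-filter⁺ P? (∈-four (kind v)) Pv) (∈-fibre v))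

  ∈-elementsWhere⁻ : ∀ {n} {v : J n} → v ∈ elementsWhere n → P (kind v)
  ∈-elementsWhere⁻ {n} v∈ with find (∈-concatMap⁻ (fibre n) {xs = filter P? four} v∈)
  ... | k , k∈ , v∈k rewrite fibre-kind k v∈k = proj₂ (∈-filter⁻ P? k∈)

  elementsWhere-unique : ∀ n → Unique (elementsWhere n)
  elementsWhere-unique n =
    concatMap-unique kind (fibre-kind _) (fibre-unique n) (Unique.filter⁺ P? four-unique)

  length-elementsWhere : ∀ n → length (elementsWhere n) ≡ sum (map (fibreSize n) (filter P? four))
  length-elementsWhere n = trans (length-concatMap (fibre n) (filter P? four))
                                 (cong sum (map-cong (length-fibre n) (filter P? four)))

below above : ∀ n → Four → List (J n)
below n k = elementsWhere (_≤ₖ? k) n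
above n k = elementsWhere (k ≤ₖ?_) n

belowCount aboveCount : ℕ → Four → ℕ
belowCount n top = 2 * (2 + n)
belowCount n bot = 1
belowCount n (f _) = 2 + n
belowCount n (t _) = 2 + n
aboveCount n top = 1
aboveCount n bot = 2 * (2 + n)
aboveCount n (f _) = 2 + n
aboveCount n (t _) = 2 + n

fibreSizes-sum : ∀ n → 1 + (1 + (suc n + (suc n + 0))) ≡ 2 * (2 + n)
fibreSizes-sum = solve-∀

length-below : ∀ n k → length (below n k) ≡ belowCount n k
length-below n k = trans (length-elementsWhere (_≤ₖ? k) n) (count k)
  where
  count : ∀ k → sum (map (fibreSize n) (filter (_≤ₖ? k) four)) ≡ belowCount n k
  count top = fibreSizes-sum n
  count bot = refl
  count (f 0F) = cong suc (+-identityʳ (suc n))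
  count (t 0F) = cong suc (+-identityʳ (suc n))

length-above : ∀ n k → length (above n k) ≡ aboveCount n k
length-above n k = trans (length-elementsWhere (k ≤ₖ?_) n) (count k)
  where
  count : ∀ k → sum (map (fibreSize n) (filter (k ≤ₖ?_) four)) ≡ aboveCount n k
  count top = refl
  count bot = fibreSizes-sum n
  count (f 0F) = cong suc (+-identityʳ (suc n))
  count (t 0F) = cong suc (+-identityʳ (suc n))

segments : ∀ n → Four → List (J n × J n)
segments n top = (top , top) ∷ []
segments n bot = (bot , bot) ∷ []
segments n (f _) = map (both f) (ascendingPairs (suc n))
segments n (t _) = map (both t) (ascendingPairs (suc n))

∈-segments⁺ : ∀ {n} {p q : J n} → Segment p q → (p , q) ∈ segments n (kind p)
∈-segments⁺ bot-bot = here refl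
∈-segments⁺ top-top = here refl
∈-segments⁺ (f≤f a≤b) = ∈-map⁺ (both f) (∈-ascendingPairs⁺ a≤b)
∈-segments⁺ (t≤t a≤b) = ∈-map⁺ (both t) (∈-ascendingPairs⁺ a≤b)

∈-segments⁻ : ∀ {n} k {p q : J n} → (p , q) ∈ segments n k → Segment p q × kind p ≡ k
∈-segments⁻ top (here refl) = top-top , refl
∈-segments⁻ bot (here refl) = bot-bot , refl
∈-segments⁻ (f 0F) pq∈ with ∈-map⁻ (both f) pq∈
... | _ , ab∈ , refl = f≤f (∈-ascendingPairs⁻ ab∈) , refl
∈-segments⁻ (t 0F) pq∈ with ∈-map⁻ (both t) pq∈
... | _ , ab∈ , refl = t≤t (∈-ascendingPairs⁻ ab∈) , refl

segments-unique : ∀ n k → Unique (segments n k)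
segments-unique n top = [] ∷ []
segments-unique n bot = [] ∷ []
segments-unique n (f _) = Unique.map⁺ both-f-injective (ascendingPairs-unique (suc n))
  where
  both-f-injective : ∀ {x y : Fin (suc n) × Fin (suc n)} → both f x ≡ both f y → x ≡ y
  both-f-injective {_ , _} {_ , _} refl = refl
segments-unique n (t _) = Unique.map⁺ both-t-injective (ascendingPairs-unique (suc n))
  where
  both-t-injective : ∀ {x y : Fin (suc n) × Fin (suc n)} → both t x ≡ both t y → x ≡ y
  both-t-injective {_ , _} {_ , _} refl = refl

segmentCount : ℕ → Four → ℕ
segmentCount m top = 1
segmentCount m bot = 1
segmentCount m (f _) = m
segmentCount m (t _) = m

length-segments : ∀ n k → length (segments n k) ≡ segmentCount (length (ascendingPairs (suc n))) k
length-segments n top = refl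
length-segments n bot = refl
length-segments n (f _) = length-map (both f) (ascendingPairs (suc n))
length-segments n (t _) = length-map (both t) (ascendingPairs (suc n))

assemble : ∀ {n} → ((J n × J n) × (J n × J n)) × J n → J n → Code n
assemble (((p , q) , (r , s)) , B) T = code T B p q r s

assemble-injective : ∀ {n} {x x′ : ((J n × J n) × (J n × J n)) × J n} {T T′ : J n} →
                     assemble x T ≡ assemble x′ T′ → x ≡ x′ × T ≡ T′
assemble-injective {x = ((_ , _) , (_ , _)) , _} {((_ , _) , (_ , _)) , _} refl = refl , refl

codesOfKinds : ∀ n → Four → Four → List (Code n)
codesOfKinds n k l = cartesianProductWith assemble
  (cartesianProduct (cartesianProduct (segments n k) (segments n l)) (below n (k ⊗ l))) (above n (k ⊕ l))

∈-codesOfKinds⁺ : ∀ {n} {c : Code n} → Valid c → c ∈ codesOfKinds n (kind (atF₀ c)) (kind (atT₀ c))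
∈-codesOfKinds⁺ {c = code T B p q r s} v = ∈-cartesianProductWith⁺ assemble
  (∈-cartesianProduct⁺ (∈-cartesianProduct⁺ (∈-segments⁺ (f-segment v)) (∈-segments⁺ (t-segment v)))
                       (∈-elementsWhere⁺ (_≤ₖ? _) (≤ₖ-⊗⁺ (kind B) (kind p) (kind r) (bot≤f₀ v) (bot≤t₀ v))))
  (∈-elementsWhere⁺ (_ ≤ₖ?_) (⊕-≤ₖ⁺ (kind T) (kind p) (kind r) (f₀≤top v) (t₀≤top v)))

∈-codesOfKinds⁻ : ∀ {n} k l {c : Code n} → c ∈ codesOfKinds n k l →
                  Valid c × kind (atF₀ c) ≡ k × kind (atT₀ c) ≡ l
∈-codesOfKinds⁻ {n} k l c∈ with ∈-cartesianProductWith⁻ assemble _ (above n (k ⊕ l)) c∈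
... | (((p , q) , (r , s)) , B) , T , x∈ , T∈ , refl with ∈-cartesianProduct⁻ _ (below n (k ⊗ l)) x∈
... | pqrs∈ , B∈ with ∈-cartesianProduct⁻ (segments n k) (segments n l) pqrs∈
... | pq∈ , rs∈ with ∈-segments⁻ k pq∈ | ∈-segments⁻ l rs∈
... | f-seg , refl | t-seg , refl = valid , refl , refl
  where
  B≤ : kind B ≤ₖ kind p × kind B ≤ₖ kind r
  B≤ = ≤ₖ-⊗⁻ (kind B) (kind p) (kind r) (∈-elementsWhere⁻ (_≤ₖ? _) B∈)
  ≤T : kind p ≤ₖ kind T × kind r ≤ₖ kind T
  ≤T = ⊕-≤ₖ⁻ (kind T) (kind p) (kind r) (∈-elementsWhere⁻ (_ ≤ₖ?_) T∈)
  valid : Valid (code T B p q r s)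
  valid = record { f-segment = f-seg ; t-segment = t-seg
                 ; bot≤f₀ = proj₁ B≤ ; bot≤t₀ = proj₂ B≤ ; f₀≤top = proj₁ ≤T ; t₀≤top = proj₂ ≤T }

codesOfKinds-unique : ∀ n k l → Unique (codesOfKinds n k l)
codesOfKinds-unique n k l = Unique.cartesianProductWith⁺ assemble assemble-injective
  (Unique.cartesianProduct⁺ (Unique.cartesianProduct⁺ (segments-unique n k) (segments-unique n l))
                            (elementsWhere-unique (_≤ₖ? (k ⊗ l)) n))
  (elementsWhere-unique ((k ⊕ l) ≤ₖ?_) n)

length-codesOfKinds : ∀ n k l → let m = length (ascendingPairs (suc n)) in
  length (codesOfKinds n k l) ≡
  segmentCount m k * segmentCount m l * belowCount n (k ⊗ l) * aboveCount n (k ⊕ l)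
length-codesOfKinds n k l = begin
  length (codesOfKinds n k l)
    ≡⟨ length-cartesianProductWith assemble (cartesianProduct segs (below n (k ⊗ l))) (above n (k ⊕ l)) ⟩
  length (cartesianProduct segs (below n (k ⊗ l))) * length (above n (k ⊕ l))
    ≡⟨ cong₂ _*_ (length-cartesianProductWith _,_ segs (below n (k ⊗ l))) (length-above n (k ⊕ l)) ⟩
  length segs * length (below n (k ⊗ l)) * aboveCount n (k ⊕ l)
    ≡⟨ cong₂ (λ x y → x * y * aboveCount n (k ⊕ l))
             (length-cartesianProductWith _,_ (segments n k) (segments n l)) (length-below n (k ⊗ l)) ⟩
  length (segments n k) * length (segments n l) * belowCount n (k ⊗ l) * aboveCount n (k ⊕ l)
    ≡⟨ cong₂ (λ x y → x * y * belowCount n (k ⊗ l) * aboveCount n (k ⊕ l))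
             (length-segments n k) (length-segments n l) ⟩
  segmentCount m k * segmentCount m l * belowCount n (k ⊗ l) * aboveCount n (k ⊕ l)
    ∎
  where
  m : ℕ
  m = length (ascendingPairs (suc n))
  segs : List ((J n × J n) × (J n × J n))
  segs = cartesianProduct (segments n k) (segments n l)

validCodes : ∀ n → List (Code n)
validCodes n = concatMap (λ k → concatMap (codesOfKinds n k) four) four

∈-validCodes⁺ : ∀ {n} {c : Code n} → Valid c → c ∈ validCodes n
∈-validCodes⁺ {n} {c} v =
  ∈-concatMap⁺ (λ k → concatMap (codesOfKinds n k) four) {xs = four} (lose (∈-four (kind (atF₀ c)))
    (∈-concatMap⁺ (codesOfKinds n (kind (atF₀ c))) {xs = four}
      (lose (∈-four (kind (atT₀ c))) (∈-codesOfKinds⁺ v))))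

∈-validCodes⁻ : ∀ {n} {c : Code n} → c ∈ validCodes n → Valid c
∈-validCodes⁻ {n} c∈ with find (∈-concatMap⁻ _ {xs = four} c∈)
... | k , _ , c∈k with find (∈-concatMap⁻ _ {xs = four} c∈k)
... | l , _ , c∈kl = proj₁ (∈-codesOfKinds⁻ k l c∈kl)

validCodes-unique : ∀ n → Unique (validCodes n)
validCodes-unique n = concatMap-unique (kind ∘ atF₀) f₀-kind
  (λ k → concatMap-unique (kind ∘ atT₀) (λ {l} c∈ → proj₂ (proj₂ (∈-codesOfKinds⁻ k l c∈)))
                          (codesOfKinds-unique n k) four-unique)
  four-unique
  where
  f₀-kind : ∀ {k c} → c ∈ concatMap (codesOfKinds n k) four → kind (atF₀ c) ≡ k
  f₀-kind {k} c∈ with find (∈-concatMap⁻ _ {xs = four} c∈)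
  ... | l , _ , c∈kl = proj₁ (proj₂ (∈-codesOfKinds⁻ k l c∈kl))

-- Counting valid codes

sumFour : (Four → ℕ) → ℕ
sumFour g = g top + g bot + g (f 0F) + g (t 0F)

sumFour-cong : ∀ {g h : Four → ℕ} → (∀ k → g k ≡ h k) → sumFour g ≡ sumFour h
sumFour-cong g≗h = cong₂ _+_ (cong₂ _+_ (cong₂ _+_ (g≗h top) (g≗h bot)) (g≗h (f 0F))) (g≗h (t 0F))

length-concatMap-four : ∀ {A : Set} (F : Four → List A) → length (concatMap F four) ≡ sumFour (length ∘ F)
length-concatMap-four F = trans (length-concatMap F four)
  (reassociate (length (F top)) (length (F bot)) (length (F (f 0F))) (length (F (t 0F))))
  where
  reassociate : ∀ a b c d → a + (b + (c + (d + 0))) ≡ a + b + c + d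
  reassociate = solve-∀

codeCount : ℕ → ℕ → ℕ
codeCount n m = sumFour λ k → sumFour λ l →
  segmentCount m k * segmentCount m l * belowCount n (k ⊗ l) * aboveCount n (k ⊕ l)

length-validCodes : ∀ n → length (validCodes n) ≡ codeCount n (length (ascendingPairs (suc n)))
length-validCodes n =
  trans (length-concatMap-four (λ k → concatMap (codesOfKinds n k) four)) (sumFour-cong λ k →
    trans (length-concatMap-four (codesOfKinds n k)) (sumFour-cong (length-codesOfKinds n k)))

-- Rows: kind of the image of f₀; columns: kind of the image of t₀; both in the order ⊤, ⊥, f, t.
codeCount-table : ∀ N m →
    (1 * 1 * (2 * N) * 1 + 1 * 1 * 1 * 1       + 1 * m * N * 1 + 1 * m * N * 1)
  + (1 * 1 * 1 * 1       + 1 * 1 * 1 * (2 * N) + 1 * m * 1 * N + 1 * m * 1 * N)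
  + (m * 1 * N * 1       + m * 1 * 1 * N       + m * m * N * N + m * m * 1 * 1)
  + (m * 1 * N * 1       + m * 1 * 1 * N       + m * m * 1 * 1 + m * m * N * N)
  ≡ 2 + 4 * N + 8 * m * N + 2 * m * m * (1 + N * N)
codeCount-table = solve-∀

twice-codeCount : ∀ n m → 2 * m ≡ suc n * suc (suc n) →
  2 * codeCount n m ≡ n ^ 6 + 10 * n ^ 5 + 42 * n ^ 4 + 102 * n ^ 3 + 157 * n ^ 2 + 148 * n + 72
twice-codeCount n m 2m≡ = begin
  2 * codeCount n m                                           ≡⟨ cong (2 *_) (codeCount-table N m) ⟩
  2 * (2 + 4 * N + 8 * m * N + 2 * m * m * (1 + N * N))       ≡⟨ double N m ⟩
  4 + 8 * N + 8 * (2 * m) * N + 2 * m * (2 * m) * (1 + N * N)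
    ≡⟨ cong (λ M → 4 + 8 * N + 8 * M * N + M * M * (1 + N * N)) 2m≡ ⟩
  4 + 8 * N + 8 * M * N + M * M * (1 + N * N)                 ≡⟨ expand n ⟩
  n ^ 6 + 10 * n ^ 5 + 42 * n ^ 4 + 102 * n ^ 3 + 157 * n ^ 2 + 148 * n + 72 ∎
  where
  N M : ℕ
  N = 2 + n
  M = suc n * suc (suc n)
  double : ∀ N m → 2 * (2 + 4 * N + 8 * m * N + 2 * m * m * (1 + N * N)) ≡
                   4 + 8 * N + 8 * (2 * m) * N + 2 * m * (2 * m) * (1 + N * N)
  double = solve-∀
  -- solve-∀ does not handle _^_, so this step uses the solver with explicit syntax.
  expand : ∀ n → 4 + 8 * (2 + n) + 8 * (suc n * suc (suc n)) * (2 + n)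
                 + suc n * suc (suc n) * (suc n * suc (suc n)) * (1 + (2 + n) * (2 + n)) ≡
                 n ^ 6 + 10 * n ^ 5 + 42 * n ^ 4 + 102 * n ^ 3 + 157 * n ^ 2 + 148 * n + 72
  expand = solve 1 (λ n → let N = con 2 :+ n ; M = (con 1 :+ n) :* (con 2 :+ n) in
    con 4 :+ con 8 :* N :+ con 8 :* M :* N :+ M :* M :* (con 1 :+ N :* N)
    := n :^ 6 :+ con 10 :* n :^ 5 :+ con 42 :* n :^ 4 :+ con 102 :* n :^ 3 :+ con 157 :* n :^ 2
       :+ con 148 :* n :+ con 72) refl
    where open +-*-Solver

theorem6p3 : (n : ℕ) → 1 ≤ n →
    Σ (List (Term n)) λ ts → IsTransversal ts ×
      (2 * length ts ≡ n ^ 6 + 10 * n ^ 5 + 42 * n ^ 4 + 102 * n ^ 3 + 157 * n ^ 2 + 148 * n + 72)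
theorem6p3 n _ = map realize (validCodes n) , (distinct , complete) , size
  where
  m : ℕ
  m = length (ascendingPairs (suc n))
  distinct : AllPairs (λ s u → ¬ s ≈ₜ u) (map realize (validCodes n))
  distinct = realize-distinct (All.tabulate ∈-validCodes⁻) (validCodes-unique n)
  complete : ∀ u → Any (λ s → s ≈ₜ u) (map realize (validCodes n))
  complete u = Any.map⁺ (lose (∈-validCodes⁺ (proj₁ (⟦⟧-encodable u))) (realize-encode u))
  size : 2 * length (map realize (validCodes n)) ≡
         n ^ 6 + 10 * n ^ 5 + 42 * n ^ 4 + 102 * n ^ 3 + 157 * n ^ 2 + 148 * n + 72
  size = begin
    2 * length (map realize (validCodes n)) ≡⟨ cong (2 *_) (length-map realize (validCodes n)) ⟩
    2 * length (validCodes n)               ≡⟨ cong (2 *_) (length-validCodes n) ⟩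
    2 * codeCount n m                       ≡⟨ twice-codeCount n m (length-ascendingPairs (suc n)) ⟩
    n ^ 6 + 10 * n ^ 5 + 42 * n ^ 4 + 102 * n ^ 3 + 157 * n ^ 2 + 148 * n + 72 ∎
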